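{- Let $G$ be a connected graph such that $\mathrm{Aut}(G[G])=\mathrm{Aut}(G)[\mathrm{Aut}(G)]$, and let $k$ be a natural number. Then: (i) if $D(G)>1$, then $D(G)\leq D(G^k)\leq D(G)+k-1$; (ii) if $D(G)=1$, then $D(G^k)=1$.
   Context: All graphs are finite and simple. For a graph $X$, a vertex labeling $\phi:V(X)\to\{1,\dots,r\}$ is $r$-distinguishing if the only automorphism of $X$ preserving all vertex labels is the identity; the distinguishing number $D(X)$ is the least such $r$. The lexicographic product $G[H]$ has vertex set $V(G)\times V(H)$, with $(a,x)$ adjacent to $(b,y)$ iff $ab\in E(G)$, or $a=b$ and $xy\in E(H)$. The lexicographic powers are $G^1=G$ and $G^k=G[G^{k-1}]$ for $k\geq 2$. The wreath product $\mathrm{Aut}(G)[\mathrm{Aut}(H)]$ is the subgroup of $\mathrm{Aut}(G[H])$ consisting of all maps $(g,h)\mapsto(\alpha g,\beta_g h)$ with $\alpha\in\mathrm{Aut}(G)$ and $\beta_g\in\mathrm{Aut}(H)$ for each $g\in V(G)$. -}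

module Defs where

open import Data.Nat using (ℕ; zero; suc; _*_; _≤_; NonZero)
open import Data.Bool using (Bool; true; false; _∨_; _∧_)
open import Data.Bool.Properties using (∨-identityʳ)
open import Data.Fin using (Fin; combine; remQuot)
open import Data.Fin.Properties using (_≟_)
open import Data.Fin.Permutation using (Permutation′; _⟨$⟩ʳ_)
open import Data.Product using (Σ; _×_; _,_; proj₁; proj₂; ∃)
open import Relation.Nullary using (yes; no)
open import Data.Empty using (⊥-elim)
open import Relation.Nullary.Decidable using (⌊_⌋)
open import Relation.Binary.PropositionalEquality using (_≡_; refl; sym)

record Graph : Set where
  field
    n     : ℕ
    adj   : Fin n → Fin n → Bool
    adj-sym : ∀ x y → adj x y ≡ adj y x
    adj-irrefl : ∀ x → adj x x ≡ false
open Graph public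

data Walk (X : Graph) : Fin (n X) → Fin (n X) → Set where
  here : ∀ {x} → Walk X x x
  step : ∀ {x y z} → adj X x y ≡ true → Walk X y z → Walk X x z

Connected : Graph → Set
Connected X = (1 ≤ n X) × (∀ x y → Walk X x y)

IsAut : (X : Graph) → Permutation′ (n X) → Set
IsAut X σ = ∀ x y → adj X (σ ⟨$⟩ʳ x) (σ ⟨$⟩ʳ y) ≡ adj X x y

-- Lexicographic product G[H]; the vertex (a , x) is encoded as combine a x.
private
  eqb-sym : ∀ {m} (a b : Fin m) → ⌊ a ≟ b ⌋ ≡ ⌊ b ≟ a ⌋
  eqb-sym a b with a ≟ b | b ≟ a
  ... | yes _ | yes _ = refl
  ... | no _  | no _  = refl
  ... | yes p | no q  = ⊥-elim (q (sym p))
  ... | no p  | yes q = ⊥-elim (p (sym q))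

  eqb-refl : ∀ {m} (a : Fin m) → ⌊ a ≟ a ⌋ ≡ true
  eqb-refl a with a ≟ a
  ... | yes _ = refl
  ... | no q  = ⊥-elim (q refl)

lexAdjP : (G H : Graph) → Fin (n G) × Fin (n H) → Fin (n G) × Fin (n H) → Bool
lexAdjP G H (a , x) (b , y) = adj G a b ∨ (⌊ a ≟ b ⌋ ∧ adj H x y)

lexAdj : (G H : Graph) → Fin (n G * n H) → Fin (n G * n H) → Bool
lexAdj G H i j = lexAdjP G H (remQuot {n G} (n H) i) (remQuot {n G} (n H) j)

private
  lexAdjP-sym : ∀ G H p q → lexAdjP G H p q ≡ lexAdjP G H q p
  lexAdjP-sym G H (a , x) (b , y)
    rewrite Graph.adj-sym G a b | Graph.adj-sym H x y | eqb-sym a b = refl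
  lexAdjP-irr : ∀ G H p → lexAdjP G H p p ≡ false
  lexAdjP-irr G H (a , x)
    rewrite Graph.adj-irrefl G a | eqb-refl a | Graph.adj-irrefl H x = refl

lex : Graph → Graph → Graph
lex G H = record
  { n = n G * n H
  ; adj = lexAdj G H
  ; adj-sym = λ i j → lexAdjP-sym G H (remQuot {n G} (n H) i) (remQuot {n G} (n H) j)
  ; adj-irrefl = λ i → lexAdjP-irr G H (remQuot {n G} (n H) i)
  }

lexPow : Graph → (k : ℕ) → .{{NonZero k}} → Graph
lexPow G (suc zero) = G
lexPow G (suc (suc k)) = lex G (lexPow G (suc k))

-- Labelings with labels {1,…,r}, represented by Fin r.
IsDistinguishing : (X : Graph) {r : ℕ} → (Fin (n X) → Fin r) → Set
IsDistinguishing X φ =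
  ∀ (σ : Permutation′ (n X)) → IsAut X σ →
    (∀ v → φ (σ ⟨$⟩ʳ v) ≡ φ v) → ∀ v → σ ⟨$⟩ʳ v ≡ v

HasDistLabeling : Graph → ℕ → Set
HasDistLabeling X r = Σ (Fin (n X) → Fin r) (IsDistinguishing X)

IsDistNumber : Graph → ℕ → Set
IsDistNumber X d = HasDistLabeling X d × (∀ r → HasDistLabeling X r → d ≤ r)

-- Aut(G[G]) = Aut(G)[Aut(G)] (equality of sets of permutations of V(G[G])).
WreathMap : (G : Graph) → Permutation′ (n (lex G G)) → Set
WreathMap G σ =
  Σ (Permutation′ (n G)) λ α → IsAut G α ×
  Σ (Fin (n G) → Permutation′ (n G)) λ β → (∀ g → IsAut G (β g)) ×
  (∀ g h → σ ⟨$⟩ʳ combine g h ≡ combine (α ⟨$⟩ʳ g) (β g ⟨$⟩ʳ h))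

AutLexIsWreath : Graph → Set
AutLexIsWreath G =
  (∀ σ → IsAut (lex G G) σ → WreathMap G σ) ×
  (∀ σ → WreathMap G σ → IsAut (lex G G) σ)

-- Every automorphism of G[H] maps fibres {a} × H onto fibres, i.e. lies in Aut(G)[Aut(H)],
-- as soon as H is connected and either G has no two vertices with the same closed neighbourhood
-- or the complement of H is connected (Sabidussi).  The hypothesis Aut(G[G]) = Aut(G)[Aut(G)]
-- forces one of these alternatives for G: otherwise swapping two such twins only in the fibres
-- over one side of a cut of the complement is an automorphism outside the wreath product.  Both
-- alternatives pass to the powers G^k, so every G[G^k] has only wreath automorphisms.  Then a
-- distinguishing labeling of G^(k+1) = G[G^k] restricts to a fibre, so D(G) ≤ D(G^k); asymmetry
-- is inherited by G[G^k]; and labeling (a , x) by the colour of x in G^k, with the colour φ(a)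
-- of an optimal labeling φ of G replaced by a fresh one, costs one new colour per factor.

module Submission where

open import Defs
open import Data.Bool using (Bool; true; false; _∨_)
open import Data.Bool.Properties using (∨-identityʳ; ∨-zeroʳ; ∧-identityʳ; ¬-not) renaming (_≟_ to _≟ᵇ_)
open import Data.Empty using (⊥; ⊥-elim)
open import Data.Fin using (Fin; zero; suc; combine; remQuot; toℕ; fromℕ; fromℕ<; inject₁; punchIn; punchOut)
open import Data.Fin.Properties
  using (_≟_; remQuot-combine; combine-remQuot; combine-injective; any?; all?; ¬∀⟶∃¬; <⇒notInjective;
         toℕ-injective; toℕ<n; toℕ-fromℕ; toℕ-inject₁; inject₁-injective; fromℕ≢inject₁; punchInᵢ≢i;
         punchOut-injective)
open import Data.Fin.Permutation using (Permutation′; _⟨$⟩ʳ_; _⟨$⟩ˡ_; permutation; inverseˡ; inverseʳ; transpose)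
import Data.Fin.Permutation.Components as PC
open import Data.Nat as ℕ using (ℕ; suc; _+_; _∸_; _≤_; _<_; NonZero; s≤s)
open import Data.Nat.Properties using (n<1+n; 1+n≰n; +-suc; +-identityʳ; ≤-antisym; <-irrefl)
open import Data.Product using (Σ; ∃; ∃₂; _×_; _,_; proj₁; proj₂)
open import Data.Sum as Sum using (_⊎_; inj₁; inj₂)
open import Function using (_∘_; id)
open import Function.Bundles using (Injection)
open import Function.Properties.Inverse using (Inverse⇒Injection)
open import Relation.Nullary using (¬_; Dec; yes; no; contradiction)
open import Relation.Nullary.Decidable using (¬?; ⌊_⌋; decidable-stable; _×-dec_; dec-true; dec-false; isYes≗does)
open import Relation.Binary.PropositionalEquality

isYes-true : ∀ {p} {P : Set p} (p? : Dec P) → P → ⌊ p? ⌋ ≡ true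
isYes-true p? p = trans (isYes≗does p?) (dec-true p? p)

isYes-false : ∀ {p} {P : Set p} (p? : Dec P) → ¬ P → ⌊ p? ⌋ ≡ false
isYes-false p? ¬p = trans (isYes≗does p?) (dec-false p? ¬p)

isYes-true⁻¹ : ∀ {p} {P : Set p} (p? : Dec P) → ⌊ p? ⌋ ≡ true → P
isYes-true⁻¹ (yes p) _ = p

isYes-false⁻¹ : ∀ {p} {P : Set p} (p? : Dec P) → ⌊ p? ⌋ ≡ false → ¬ P
isYes-false⁻¹ (no ¬p) _ = ¬p

isYes-≟-sym : ∀ {m} (a b : Fin m) → ⌊ a ≟ b ⌋ ≡ ⌊ b ≟ a ⌋
isYes-≟-sym a b with a ≟ b
... | yes refl = sym (isYes-true (a ≟ a) refl)
... | no a≢b = sym (isYes-false (b ≟ a) (a≢b ∘ sym))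

Fin1-unique : (i j : Fin 1) → i ≡ j
Fin1-unique zero zero = refl

permutation-injective : ∀ {m} (π : Permutation′ m) {a b} → π ⟨$⟩ʳ a ≡ π ⟨$⟩ʳ b → a ≡ b
permutation-injective π = Injection.injective (Inverse⇒Injection π)

distinct-values⇒true×false : ∀ {a} {A : Set a} (f : A → Bool) {x y} → f x ≢ f y →
  (∃ λ s → f s ≡ true) × (∃ λ t → f t ≡ false)
distinct-values⇒true×false f {x} {y} fx≢fy with f x in fx | f y in fy
... | true  | true  = contradiction refl fx≢fy
... | true  | false = (x , fx) , (y , fy)
... | false | true  = (y , fy) , (x , fx)
... | false | false = contradiction refl fx≢fy

Crossed : (X : Graph) → (Fin (n X) → Bool) → Bool → Set
Crossed X S b = ∃₂ λ s t → S s ≡ true × S t ≡ false × adj X s t ≡ b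

-- Connectedness, via cuts, of the graph whose edges are the pairs of adjacency b:
-- X itself for b = true, its complement for b = false.
ConnectedBy : Graph → Bool → Set
ConnectedBy X b = ∀ S → (∃ λ s → S s ≡ true) → (∃ λ t → S t ≡ false) → Crossed X S b

walk-crossed : ∀ X S {x y} → Walk X x y → S x ≡ true → S y ≡ false → Crossed X S true
walk-crossed X S here Sx Sy = contradiction (trans (sym Sx) Sy) λ ()
walk-crossed X S (step {x} {y} xy w) Sx Sz with S y in Sy
... | true  = walk-crossed X S w Sy Sz
... | false = x , y , Sx , Sy , xy

connected⇒connectedBy-true : ∀ X → Connected X → ConnectedBy X true
connected⇒connectedBy-true X (_ , walk) S (s , Ss) (t , St) = walk-crossed X S (walk s t) Ss St

closedAdj : (X : Graph) → Fin (n X) → Fin (n X) → Bool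
closedAdj X a b = adj X a b ∨ ⌊ a ≟ b ⌋

closedAdj-sym : ∀ X a b → closedAdj X a b ≡ closedAdj X b a
closedAdj-sym X a b = cong₂ _∨_ (adj-sym X a b) (isYes-≟-sym a b)

closedAdj-refl : ∀ X a → closedAdj X a a ≡ true
closedAdj-refl X a rewrite isYes-true (a ≟ a) refl = ∨-zeroʳ (adj X a a)

closedAdj-≢ : ∀ X {a b} → a ≢ b → closedAdj X a b ≡ adj X a b
closedAdj-≢ X {a} {b} a≢b rewrite isYes-false (a ≟ b) a≢b = ∨-identityʳ (adj X a b)

closedAdj-adj : ∀ X {a b} → adj X a b ≡ true → closedAdj X a b ≡ true
closedAdj-adj X ab rewrite ab = refl

Twins : (X : Graph) → Fin (n X) → Fin (n X) → Set
Twins X u v = ∀ w → closedAdj X u w ≡ closedAdj X v w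

TwinFree : Graph → Set
TwinFree X = ∀ u v → Twins X u v → u ≡ v

twins-transpose : ∀ X {u v} → Twins X u v → ∀ a → Twins X (PC.transpose u v a) a
twins-transpose X {u} {v} uv a with a ≟ u
... | yes refl = λ w → sym (uv w)
... | no _ with a ≟ v
...   | yes refl = uv
...   | no _ = λ _ → refl

transpose-moves : ∀ {m} {u v : Fin m} → u ≢ v → PC.transpose u v u ≢ u
transpose-moves {u = u} u≢v with u ≟ u
... | yes _   = u≢v ∘ sym
... | no u≢u = contradiction refl u≢u

twin-moving-aut : ∀ X (τ : Permutation′ (n X)) → (∀ a → Twins X (τ ⟨$⟩ʳ a) a) → IsAut X τ
twin-moving-aut X τ τ-twin a b with a ≟ b
... | yes refl = trans (adj-irrefl X _) (sym (adj-irrefl X a))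
... | no a≢b = begin
  adj X (τ ⟨$⟩ʳ a) (τ ⟨$⟩ʳ b)       ≡⟨ sym (closedAdj-≢ X (a≢b ∘ permutation-injective τ)) ⟩
  closedAdj X (τ ⟨$⟩ʳ a) (τ ⟨$⟩ʳ b) ≡⟨ τ-twin a _ ⟩
  closedAdj X a (τ ⟨$⟩ʳ b)           ≡⟨ closedAdj-sym X a _ ⟩
  closedAdj X (τ ⟨$⟩ʳ b) a           ≡⟨ τ-twin b a ⟩
  closedAdj X b a                     ≡⟨ closedAdj-sym X b a ⟩
  closedAdj X a b                     ≡⟨ closedAdj-≢ X a≢b ⟩
  adj X a b                           ∎
  where open ≡-Reasoning

module Lex (G H : Graph) where

  Pair : Set
  Pair = Fin (n G) × Fin (n H)

  pair : Pair → Fin (n (lex G H))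
  pair (a , x) = combine a x

  unpair : Fin (n (lex G H)) → Pair
  unpair = remQuot {n G} (n H)

  unpair-pair : ∀ p → unpair (pair p) ≡ p
  unpair-pair (a , x) = remQuot-combine a x

  pair-unpair : ∀ i → pair (unpair i) ≡ i
  pair-unpair = combine-remQuot {n G} (n H)

  adj-pair : ∀ p q → adj (lex G H) (pair p) (pair q) ≡ lexAdjP G H p q
  adj-pair p q = cong₂ (lexAdjP G H) (unpair-pair p) (unpair-pair q)

  lexAdjP-fibre : ∀ a x y → lexAdjP G H (a , x) (a , y) ≡ adj H x y
  lexAdjP-fibre a x y rewrite adj-irrefl G a | isYes-true (a ≟ a) refl = refl

  lexAdjP-≢ : ∀ {a b} x y → a ≢ b → lexAdjP G H (a , x) (b , y) ≡ adj G a b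
  lexAdjP-≢ {a} {b} x y a≢b rewrite isYes-false (a ≟ b) a≢b = ∨-identityʳ (adj G a b)

  lexAdjP-joined : ∀ a b {x y} → adj H x y ≡ true → lexAdjP G H (a , x) (b , y) ≡ closedAdj G a b
  lexAdjP-joined a b xy rewrite xy = cong (adj G a b ∨_) (∧-identityʳ ⌊ a ≟ b ⌋)

  lexAdjP-aut : (α : Permutation′ (n G)) → IsAut G α →
    ∀ a b x y → lexAdjP G H (α ⟨$⟩ʳ a , x) (α ⟨$⟩ʳ b , y) ≡ lexAdjP G H (a , x) (b , y)
  lexAdjP-aut α α-aut a b x y = byCases (a ≟ b)
    where
    byCases : Dec (a ≡ b) → lexAdjP G H (α ⟨$⟩ʳ a , x) (α ⟨$⟩ʳ b , y) ≡ lexAdjP G H (a , x) (b , y)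
    byCases (yes refl) = trans (lexAdjP-fibre _ x y) (sym (lexAdjP-fibre a x y))
    byCases (no a≢b)   = trans (lexAdjP-≢ x y (a≢b ∘ permutation-injective α))
                               (trans (α-aut a b) (sym (lexAdjP-≢ x y a≢b)))

  record PairAut : Set where
    field
      to from : Pair → Pair
      from-to : ∀ p → from (to p) ≡ p
      to-from : ∀ p → to (from p) ≡ p
      to-adj  : ∀ p q → lexAdjP G H (to p) (to q) ≡ lexAdjP G H p q

    from-adj : ∀ p q → lexAdjP G H (from p) (from q) ≡ lexAdjP G H p q
    from-adj p q = trans (sym (to-adj (from p) (from q))) (cong₂ (lexAdjP G H) (to-from p) (to-from q))

  inverse : PairAut → PairAut
  inverse π = record { to = from ; from = to ; from-to = to-from ; to-from = from-to ; to-adj = from-adj }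
    where open PairAut π

  aut⇒pairAut : ∀ σ → IsAut (lex G H) σ → PairAut
  aut⇒pairAut σ σ-aut = record
    { to      = λ p → unpair (σ ⟨$⟩ʳ pair p)
    ; from    = λ p → unpair (σ ⟨$⟩ˡ pair p)
    ; from-to = λ p → trans (cong (unpair ∘ (σ ⟨$⟩ˡ_)) (pair-unpair _))
                            (trans (cong unpair (inverseˡ σ)) (unpair-pair p))
    ; to-from = λ p → trans (cong (unpair ∘ (σ ⟨$⟩ʳ_)) (pair-unpair _))
                            (trans (cong unpair (inverseʳ σ)) (unpair-pair p))
    ; to-adj  = λ p q → trans (σ-aut (pair p) (pair q)) (adj-pair p q)
    }

  toPermutation : PairAut → Permutation′ (n (lex G H))
  toPermutation π = permutation (pair ∘ to ∘ unpair) (pair ∘ from ∘ unpair)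
    (λ i → trans (cong (pair ∘ to) (unpair-pair _)) (trans (cong pair (to-from _)) (pair-unpair i)))
    (λ i → trans (cong (pair ∘ from) (unpair-pair _)) (trans (cong pair (from-to _)) (pair-unpair i)))
    where open PairAut π

  toPermutation-pair : ∀ π p → toPermutation π ⟨$⟩ʳ pair p ≡ pair (PairAut.to π p)
  toPermutation-pair π p = cong (pair ∘ PairAut.to π) (unpair-pair p)

  toPermutation-aut : ∀ π → IsAut (lex G H) (toPermutation π)
  toPermutation-aut π i j =
    trans (cong₂ (lexAdjP G H) (unpair-pair _) (unpair-pair _)) (PairAut.to-adj π _ _)

  IsWreath : Permutation′ (n (lex G H)) → Set
  IsWreath σ = Σ (Permutation′ (n G)) λ α → IsAut G α ×
    Σ (Fin (n G) → Permutation′ (n H)) λ β → (∀ g → IsAut H (β g)) ×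
    (∀ g h → σ ⟨$⟩ʳ pair (g , h) ≡ pair (α ⟨$⟩ʳ g , β g ⟨$⟩ʳ h))

  wreath-identity : ∀ σ (α : Permutation′ (n G)) (β : Fin (n G) → Permutation′ (n H)) →
    (∀ g h → σ ⟨$⟩ʳ pair (g , h) ≡ pair (α ⟨$⟩ʳ g , β g ⟨$⟩ʳ h)) →
    (∀ g → α ⟨$⟩ʳ g ≡ g) → (∀ g h → β g ⟨$⟩ʳ h ≡ h) → ∀ i → σ ⟨$⟩ʳ i ≡ i
  wreath-identity σ α β σ-pair α-id β-id i = begin
    σ ⟨$⟩ʳ i                                ≡⟨ cong (σ ⟨$⟩ʳ_) (sym (pair-unpair i)) ⟩
    σ ⟨$⟩ʳ pair (g , h)                     ≡⟨ σ-pair g h ⟩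
    pair (α ⟨$⟩ʳ g , β g ⟨$⟩ʳ h)            ≡⟨ cong₂ (λ g′ h′ → pair (g′ , h′)) (α-id g) (β-id g h) ⟩
    pair (g , h)                            ≡⟨ pair-unpair i ⟩
    i                                       ∎
    where
    open ≡-Reasoning
    g = proj₁ (unpair i)
    h = proj₂ (unpair i)

  lex-connectedBy : ∀ {b} → Fin (n H) → ConnectedBy G b → ConnectedBy H b → ConnectedBy (lex G H) b
  lex-connectedBy {b} h₀ G-conn H-conn S (s , Ss) (t , St)
    with any? (λ a → any? (λ x → ¬? (S (pair (a , x)) ≟ᵇ S (pair (a , h₀)))))
  ... | yes (a , x , Sx≢Sh₀) = inFibre (distinct-values⇒true×false (λ y → S (pair (a , y))) Sx≢Sh₀)
    where
    inFibre : (∃ λ y → S (pair (a , y)) ≡ true) × (∃ λ z → S (pair (a , z)) ≡ false) → Crossed (lex G H) S b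
    inFibre (inside , outside) with H-conn (λ y → S (pair (a , y))) inside outside
    ... | y₁ , y₂ , S₁ , S₂ , y₁y₂ = pair (a , y₁) , pair (a , y₂) , S₁ , S₂ ,
                                      trans (adj-pair _ _) (trans (lexAdjP-fibre a y₁ y₂) y₁y₂)
  ... | no constant with G-conn S′ (_ , trans (sym (S-fibre s)) Ss) (_ , trans (sym (S-fibre t)) St)
    where
    S′ : Fin (n G) → Bool
    S′ a = S (pair (a , h₀))
    S-fibre : ∀ i → S i ≡ S′ (proj₁ (unpair i))
    S-fibre i = trans (cong S (sym (pair-unpair i)))
                      (decidable-stable (_ ≟ᵇ _) (λ ne → constant (_ , _ , ne)))
  ... | a₁ , a₂ , S₁ , S₂ , a₁a₂ = pair (a₁ , h₀) , pair (a₂ , h₀) , S₁ , S₂ ,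
        trans (adj-pair _ _) (trans (lexAdjP-≢ h₀ h₀ (λ { refl → contradiction (trans (sym S₁) S₂) λ () })) a₁a₂)

module Decomposition (G H : Graph) (H-connected : ConnectedBy H true)
                     (G-twinFree⊎H-coconnected : TwinFree G ⊎ ConnectedBy H false) where
  open Lex G H
  open ≡-Reasoning

  module FibreImage (π : PairAut) (c : Fin (n G)) where
    open PairAut π

    image : Fin (n H) → Pair
    image x = to (c , x)

    base : Fin (n H) → Fin (n G)
    base x = proj₁ (image x)

    adj-image-≢ : ∀ e w x → base x ≢ e → lexAdjP G H (e , w) (image x) ≡ adj G e (base x)
    adj-image-≢ e w x bx≢e = lexAdjP-≢ w (proj₂ (image x)) (bx≢e ∘ sym)

    adj-image-offFibre : ∀ p → proj₁ (from p) ≢ c → ∀ x → lexAdjP G H p (image x) ≡ adj G (proj₁ (from p)) c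
    adj-image-offFibre p off x = begin
      lexAdjP G H p (image x)              ≡⟨ cong (λ q → lexAdjP G H q (image x)) (sym (to-from p)) ⟩
      lexAdjP G H (to (from p)) (to (c , x)) ≡⟨ to-adj (from p) (c , x) ⟩
      lexAdjP G H (from p) (c , x)         ≡⟨ lexAdjP-≢ (proj₂ (from p)) x off ⟩
      adj G (proj₁ (from p)) c             ∎

    image-crossing : ∀ {b} → ConnectedBy H b → ∀ {e x y} → base x ≡ e → base y ≢ e →
      ∃ λ z → base z ≢ e × adj G e (base z) ≡ b
    image-crossing {b} H-conn {e} {x} {y} bx≡e by≢e
      with H-conn (λ z → ⌊ base z ≟ e ⌋) (x , isYes-true (_ ≟ e) bx≡e) (y , isYes-false (_ ≟ e) by≢e)
    ... | z₁ , z₂ , S₁ , S₂ , z₁z₂ = z₂ , bz₂≢e , (begin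
      adj G e (base z₂)                       ≡⟨ cong (λ a → adj G a (base z₂)) (sym bz₁≡e) ⟩
      adj G (base z₁) (base z₂)               ≡⟨ sym (lexAdjP-≢ _ _ (λ eq → bz₂≢e (trans (sym eq) bz₁≡e))) ⟩
      lexAdjP G H (image z₁) (image z₂)       ≡⟨ to-adj (c , z₁) (c , z₂) ⟩
      lexAdjP G H (c , z₁) (c , z₂)           ≡⟨ lexAdjP-fibre c z₁ z₂ ⟩
      adj H z₁ z₂                             ≡⟨ z₁z₂ ⟩
      b                                       ∎)
      where
      bz₁≡e = isYes-true⁻¹ (base z₁ ≟ e) S₁
      bz₂≢e = isYes-false⁻¹ (base z₂ ≟ e) S₂

    -- The image of fibre c has only n H points, so it cannot contain a whole fibre e and more.
    fibre-not-covered : ∀ {e y} → base y ≢ e → ¬ (∀ w → proj₁ (from (e , w)) ≡ c)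
    fibre-not-covered {e} {y} by≢e covered = <⇒notInjective (n<1+n (n H)) f-injective
      where
      preimage : Fin (n H) → Fin (n H)
      preimage w = proj₂ (from (e , w))
      image-preimage : ∀ w → image (preimage w) ≡ (e , w)
      image-preimage w = trans (cong (λ a → to (a , preimage w)) (sym (covered w))) (to-from (e , w))
      f : Fin (suc (n H)) → Fin (n H)
      f zero    = y
      f (suc w) = preimage w
      f-injective : ∀ {i j} → f i ≡ f j → i ≡ j
      f-injective {zero}  {zero}   _  = refl
      f-injective {zero}  {suc w}  eq = contradiction (cong proj₁ (trans (cong image eq) (image-preimage w))) by≢e
      f-injective {suc w} {zero}   eq = contradiction (cong proj₁ (trans (cong image (sym eq)) (image-preimage w))) by≢e
      f-injective {suc w} {suc w′} eq =
        cong suc (cong proj₂ (trans (sym (image-preimage w)) (trans (cong image eq) (image-preimage w′))))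

    Dominates : Fin (n G) → Set
    Dominates e = ∀ z → base z ≢ e → adj G e (base z) ≡ true

    -- A vertex (e , w) whose preimage lies outside fibre c is adjacent to all of the image
    -- of fibre c or to none of it; an image edge leaving e decides which.
    dominates : ∀ {e x y} → base x ≡ e → base y ≢ e → Dominates e
    dominates {e} {x} {y} bx≡e by≢e z bz≢e
      with ¬∀⟶∃¬ (n H) _ (λ w → proj₁ (from (e , w)) ≟ c) (fibre-not-covered by≢e)
    ... | w , off with image-crossing H-connected bx≡e by≢e
    ...   | z₀ , bz₀≢e , ez₀ = begin
      adj G e (base z)              ≡⟨ sym (adj-image-≢ e w z bz≢e) ⟩
      lexAdjP G H (e , w) (image z) ≡⟨ adj-image-offFibre (e , w) off z ⟩
      adj G (proj₁ (from (e , w))) c ≡⟨ sym (adj-image-offFibre (e , w) off z₀) ⟩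
      lexAdjP G H (e , w) (image z₀) ≡⟨ adj-image-≢ e w z₀ bz₀≢e ⟩
      adj G e (base z₀)             ≡⟨ ez₀ ⟩
      true                          ∎

    dominating-twins : ∀ x y → base x ≢ base y → Dominates (base x) → Dominates (base y) →
      Twins G (base x) (base y)
    dominating-twins x y bx≢by dom-x dom-y u with u ≟ base x | u ≟ base y
    ... | yes refl | _ = trans (closedAdj-refl G _) (sym (closedAdj-adj G (dom-y x bx≢by)))
    ... | no _ | yes refl = trans (closedAdj-adj G (dom-x y (bx≢by ∘ sym))) (sym (closedAdj-refl G _))
    ... | no u≢bx | no u≢by = begin
      closedAdj G (base x) u ≡⟨ closedAdj-≢ G (u≢bx ∘ sym) ⟩
      adj G (base x) u       ≡⟨ same-adj (proj₁ (from (u , x)) ≟ c) ⟩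
      adj G (base y) u       ≡⟨ sym (closedAdj-≢ G (u≢by ∘ sym)) ⟩
      closedAdj G (base y) u ∎
      where
      same-adj : Dec (proj₁ (from (u , x)) ≡ c) → adj G (base x) u ≡ adj G (base y) u
      same-adj (yes onFibre) = begin
        adj G (base x) u ≡⟨ cong (adj G (base x)) (sym bz≡u) ⟩
        adj G (base x) (base z) ≡⟨ dom-x z (u≢bx ∘ trans (sym bz≡u)) ⟩
        true ≡⟨ sym (dom-y z (u≢by ∘ trans (sym bz≡u))) ⟩
        adj G (base y) (base z) ≡⟨ cong (adj G (base y)) bz≡u ⟩
        adj G (base y) u ∎
        where
        z = proj₂ (from (u , x))
        bz≡u : base z ≡ u
        bz≡u = cong proj₁ (trans (cong (λ a → to (a , z)) (sym onFibre)) (to-from (u , x)))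
      same-adj (no off) = begin
        adj G (base x) u               ≡⟨ adj-sym G _ u ⟩
        adj G u (base x)               ≡⟨ sym (adj-image-≢ u x x (u≢bx ∘ sym)) ⟩
        lexAdjP G H (u , x) (image x)  ≡⟨ adj-image-offFibre (u , x) off x ⟩
        adj G (proj₁ (from (u , x))) c ≡⟨ sym (adj-image-offFibre (u , x) off y) ⟩
        lexAdjP G H (u , x) (image y)  ≡⟨ adj-image-≢ u x y (u≢by ∘ sym) ⟩
        adj G u (base y)               ≡⟨ adj-sym G u _ ⟩
        adj G (base y) u               ∎

    base-constant : ∀ x y → base x ≡ base y
    base-constant x y = decidable-stable (base x ≟ base y) (distinct-bases-absurd G-twinFree⊎H-coconnected)
      where
      distinct-bases-absurd : TwinFree G ⊎ ConnectedBy H false → base x ≢ base y → ⊥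
      distinct-bases-absurd (inj₁ twinFree) bx≢by =
        bx≢by (twinFree _ _ (dominating-twins x y bx≢by (dominates refl (bx≢by ∘ sym)) (dominates refl bx≢by)))
      distinct-bases-absurd (inj₂ H-coconnected) bx≢by
        with image-crossing H-coconnected refl (bx≢by ∘ sym)
      ... | z , bz≢bx , nonadj =
        contradiction (trans (sym (dominates refl (bx≢by ∘ sym) z bz≢bx)) nonadj) λ ()

  fibre-preserving : ∀ (π : PairAut) c x y → proj₁ (PairAut.to π (c , x)) ≡ proj₁ (PairAut.to π (c , y))
  fibre-preserving π c = FibreImage.base-constant π c

  aut⇒wreath : Fin (n H) → ∀ σ → IsAut (lex G H) σ → IsWreath σ
  aut⇒wreath h₀ σ σ-aut = α , α-aut , β , β-aut , σ-pair
    where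
    π = aut⇒pairAut σ σ-aut
    open PairAut π

    α⃗ α⃖ : Fin (n G) → Fin (n G)
    α⃗ a = proj₁ (to (a , h₀))
    α⃖ b = proj₁ (from (b , h₀))

    α⃖-α⃗ : ∀ a → α⃖ (α⃗ a) ≡ a
    α⃖-α⃗ a = trans (fibre-preserving (inverse π) (α⃗ a) h₀ _) (cong proj₁ (from-to (a , h₀)))

    α⃗-α⃖ : ∀ b → α⃗ (α⃖ b) ≡ b
    α⃗-α⃖ b = trans (fibre-preserving π (α⃖ b) h₀ _) (cong proj₁ (to-from (b , h₀)))

    α : Permutation′ (n G)
    α = permutation α⃗ α⃖ α⃗-α⃖ α⃖-α⃗

    β⃗ β⃖ : Fin (n G) → Fin (n H) → Fin (n H)
    β⃗ a x = proj₂ (to (a , x))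
    β⃖ a y = proj₂ (from (α⃗ a , y))

    to-split : ∀ a x → to (a , x) ≡ (α⃗ a , β⃗ a x)
    to-split a x = cong (_, β⃗ a x) (fibre-preserving π a x h₀)

    from-split : ∀ a y → from (α⃗ a , y) ≡ (a , β⃖ a y)
    from-split a y = cong (_, β⃖ a y) (trans (fibre-preserving (inverse π) (α⃗ a) y h₀) (α⃖-α⃗ a))

    β⃖-β⃗ : ∀ a x → β⃖ a (β⃗ a x) ≡ x
    β⃖-β⃗ a x = cong proj₂ (trans (cong from (sym (to-split a x))) (from-to (a , x)))

    β⃗-β⃖ : ∀ a y → β⃗ a (β⃖ a y) ≡ y
    β⃗-β⃖ a y = cong proj₂ (trans (cong to (sym (from-split a y))) (to-from (α⃗ a , y)))

    β : Fin (n G) → Permutation′ (n H)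
    β a = permutation (β⃗ a) (β⃖ a) (β⃗-β⃖ a) (β⃖-β⃗ a)

    α-aut : IsAut G α
    α-aut a b with a ≟ b
    ... | yes refl = trans (adj-irrefl G _) (sym (adj-irrefl G a))
    ... | no a≢b = begin
      adj G (α⃗ a) (α⃗ b)                       ≡⟨ sym (lexAdjP-≢ _ _ (a≢b ∘ permutation-injective α)) ⟩
      lexAdjP G H (to (a , h₀)) (to (b , h₀)) ≡⟨ to-adj (a , h₀) (b , h₀) ⟩
      lexAdjP G H (a , h₀) (b , h₀)           ≡⟨ lexAdjP-≢ h₀ h₀ a≢b ⟩
      adj G a b                               ∎

    β-aut : ∀ a → IsAut H (β a)
    β-aut a x y = begin
      adj H (β⃗ a x) (β⃗ a y)                        ≡⟨ sym (lexAdjP-fibre (α⃗ a) _ _) ⟩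
      lexAdjP G H (α⃗ a , β⃗ a x) (α⃗ a , β⃗ a y)   ≡⟨ sym (cong₂ (lexAdjP G H) (to-split a x) (to-split a y)) ⟩
      lexAdjP G H (to (a , x)) (to (a , y))         ≡⟨ to-adj (a , x) (a , y) ⟩
      lexAdjP G H (a , x) (a , y)                   ≡⟨ lexAdjP-fibre a x y ⟩
      adj H x y                                     ∎

    σ-pair : ∀ a x → σ ⟨$⟩ʳ pair (a , x) ≡ pair (α⃗ a , β⃗ a x)
    σ-pair a x = trans (sym (pair-unpair _)) (cong pair (to-split a x))

module TwinShift (G : Graph) (τ : Permutation′ (n G)) (τ-twin : ∀ a → Twins G (τ ⟨$⟩ʳ a) a)
                 (S : Fin (n G) → Bool) (S-joined : ∀ x y → S x ≡ true → S y ≡ false → adj G x y ≡ true) where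
  open Lex G G
  open ≡-Reasoning

  move : (Fin (n G) → Fin (n G)) → Bool → Fin (n G) → Fin (n G)
  move f true  = f
  move f false = id

  shift : (Fin (n G) → Fin (n G)) → Pair → Pair
  shift f (a , x) = move f (S x) a , x

  shift-inverse : ∀ {f g} → (∀ a → g (f a) ≡ a) → ∀ p → shift g (shift f p) ≡ p
  shift-inverse {f} {g} gf (a , x) with S x
  ... | true  = cong (_, x) (gf a)
  ... | false = refl

  shift-adj : ∀ p q → lexAdjP G G (shift (τ ⟨$⟩ʳ_) p) (shift (τ ⟨$⟩ʳ_) q) ≡ lexAdjP G G p q
  shift-adj (a , x) (b , y) with S x in Sx | S y in Sy
  ... | true  | true  = lexAdjP-aut τ (twin-moving-aut G τ τ-twin) a b x y
  ... | false | false = refl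
  ... | true  | false = begin
    lexAdjP G G (τ ⟨$⟩ʳ a , x) (b , y) ≡⟨ lexAdjP-joined _ b (S-joined x y Sx Sy) ⟩
    closedAdj G (τ ⟨$⟩ʳ a) b            ≡⟨ τ-twin a b ⟩
    closedAdj G a b                     ≡⟨ sym (lexAdjP-joined a b (S-joined x y Sx Sy)) ⟩
    lexAdjP G G (a , x) (b , y)         ∎
  ... | false | true  = begin
    lexAdjP G G (a , x) (τ ⟨$⟩ʳ b , y) ≡⟨ lexAdjP-joined a _ yx ⟩
    closedAdj G a (τ ⟨$⟩ʳ b)            ≡⟨ closedAdj-sym G a _ ⟩
    closedAdj G (τ ⟨$⟩ʳ b) a            ≡⟨ τ-twin b a ⟩
    closedAdj G b a                     ≡⟨ closedAdj-sym G b a ⟩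
    closedAdj G a b                     ≡⟨ sym (lexAdjP-joined a b yx) ⟩
    lexAdjP G G (a , x) (b , y)         ∎
    where yx = trans (adj-sym G x y) (S-joined y x Sy Sx)

  shiftAut : PairAut
  shiftAut = record
    { to      = shift (τ ⟨$⟩ʳ_)
    ; from    = shift (τ ⟨$⟩ˡ_)
    ; from-to = shift-inverse (λ _ → inverseˡ τ)
    ; to-from = shift-inverse (λ _ → inverseʳ τ)
    ; to-adj  = shift-adj
    }

  shift-wreath⇒τ-identity : ∀ {s t} → S s ≡ true → S t ≡ false →
    IsWreath (toPermutation shiftAut) → ∀ a → τ ⟨$⟩ʳ a ≡ a
  shift-wreath⇒τ-identity {s} {t} Ss St (α , _ , β , _ , σ-pair) a = begin
    τ ⟨$⟩ʳ a                   ≡⟨ cong (λ b → move (τ ⟨$⟩ʳ_) b a) (sym Ss) ⟩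
    move (τ ⟨$⟩ʳ_) (S s) a     ≡⟨ fibre-image s ⟩
    α ⟨$⟩ʳ a                   ≡⟨ sym (fibre-image t) ⟩
    move (τ ⟨$⟩ʳ_) (S t) a     ≡⟨ cong (λ b → move (τ ⟨$⟩ʳ_) b a) St ⟩
    a                          ∎
    where
    fibre-image : ∀ x → move (τ ⟨$⟩ʳ_) (S x) a ≡ α ⟨$⟩ʳ a
    fibre-image x = proj₁ (combine-injective _ _ _ _
      (trans (sym (toPermutation-pair shiftAut (a , x))) (σ-pair a x)))

-- A twin pair u ≠ v and a cut of G with no non-edge across it give the automorphism of G[G]
-- swapping u and v in the fibres over one side of the cut only, which is not in the wreath product.
wreath⇒twinFree⊎coconnected : ∀ G → AutLexIsWreath G → TwinFree G ⊎ ConnectedBy G false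
wreath⇒twinFree⊎coconnected G (wreath , _)
  with any? (λ u → any? (λ v → ¬? (u ≟ v) ×-dec all? (λ w → closedAdj G u w ≟ᵇ closedAdj G v w)))
... | no noTwins = inj₁ λ u v uv → decidable-stable (u ≟ v) (λ u≢v → noTwins (u , v , u≢v , uv))
... | yes (u , v , u≢v , uv) = inj₂ coconnected
  where
  coconnected : ConnectedBy G false
  coconnected S (s , Ss) (t , St)
    with any? (λ x → any? (λ y → (S x ≟ᵇ true) ×-dec (S y ≟ᵇ false) ×-dec (adj G x y ≟ᵇ false)))
  ... | yes (x , y , Sx , Sy , xy) = x , y , Sx , Sy , xy
  ... | no noNonEdge = ⊥-elim (transpose-moves u≢v (shift-wreath⇒τ-identity Ss St wreath-shift u))
    where
    open Lex G G using (toPermutation; toPermutation-aut)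
    open TwinShift G (transpose u v) (twins-transpose G uv) S
                   (λ x y Sx Sy → ¬-not (λ xy → noNonEdge (x , y , Sx , Sy , xy)))
    wreath-shift = wreath (toPermutation shiftAut) (toPermutation-aut shiftAut)

Asymmetric : Graph → Set
Asymmetric X = ∀ σ → IsAut X σ → ∀ v → σ ⟨$⟩ʳ v ≡ v

asymmetric⇒1-labeling : ∀ X → Asymmetric X → HasDistLabeling X 1
asymmetric⇒1-labeling X X-asym = (λ _ → zero) , λ σ σ-aut _ → X-asym σ σ-aut

1-labeling⇒asymmetric : ∀ X → HasDistLabeling X 1 → Asymmetric X
1-labeling⇒asymmetric X (φ , φ-dist) σ σ-aut = φ-dist σ σ-aut (λ v → Fin1-unique _ _)

minimal-labeling-surjective : ∀ X {d} (φ : Fin (n X) → Fin d) → IsDistinguishing X φ →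
  (∀ r → HasDistLabeling X r → d ≤ r) → ∀ j → ∃ λ v → φ v ≡ j
minimal-labeling-surjective X {suc d} φ φ-dist minimal j with any? (λ v → φ v ≟ j)
... | yes hit = hit
... | no miss = contradiction (minimal d (φ′ , φ′-dist)) 1+n≰n
  where
  j≢φ : ∀ v → j ≢ φ v
  j≢φ v j≡φv = miss (v , sym j≡φv)
  φ′ : Fin (n X) → Fin d
  φ′ v = punchOut (j≢φ v)
  φ′-dist : IsDistinguishing X φ′
  φ′-dist σ σ-aut pres = φ-dist σ σ-aut (λ v → punchOut-injective (j≢φ _) (j≢φ v) (pres v))

recolour : ∀ {r} → ℕ → Fin r → Fin (suc r)
recolour {r} j c with toℕ c ℕ.≟ j
... | yes _ = fromℕ r
... | no  _ = inject₁ c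

recolour-injective : ∀ {r} j {c c′ : Fin r} → recolour j c ≡ recolour j c′ → c ≡ c′
recolour-injective j {c} {c′} eq with toℕ c ℕ.≟ j | toℕ c′ ℕ.≟ j
... | yes c≡j | yes c′≡j = toℕ-injective (trans c≡j (sym c′≡j))
... | yes _   | no  _    = contradiction eq fromℕ≢inject₁
... | no  _   | yes _    = contradiction (sym eq) fromℕ≢inject₁
... | no  _   | no  _    = inject₁-injective eq

toℕ-recolour-≢ : ∀ {r} j (c : Fin r) → toℕ (recolour j c) ≢ j
toℕ-recolour-≢ {r} j c eq with toℕ c ℕ.≟ j
... | yes c≡j = <-irrefl (trans c≡j (trans (sym eq) (toℕ-fromℕ r))) (toℕ<n c)
... | no  c≢j = c≢j (trans (sym (toℕ-inject₁ c)) eq)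

toℕ-recolour-keep : ∀ {r} j (c : Fin r) → toℕ c ≢ j → toℕ (recolour j c) ≡ toℕ c
toℕ-recolour-keep j c c≢j with toℕ c ℕ.≟ j
... | yes c≡j = contradiction c≡j c≢j
... | no  _   = toℕ-inject₁ c

HasCoveringDistLabeling : Graph → ℕ → ℕ → Set
HasCoveringDistLabeling X d r = Σ (Fin (n X) → Fin r) λ Λ → IsDistinguishing X Λ ×
  ((j : Fin d) → ∃ λ v → toℕ (Λ v) ≡ toℕ j)

otherColour : ∀ {d} → 1 < d → (j : Fin d) → ∃ λ j′ → j′ ≢ j
otherColour {suc (suc _)} _ j = punchIn j zero , punchInᵢ≢i j zero
otherColour {suc ℕ.zero} (s≤s ()) _

module LexLabelings (G H : Graph) where
  open Lex G H
  open ≡-Reasoning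

  onFibre : Fin (n G) → (Fin (n H) → Fin (n H)) → Pair → Pair
  onFibre a₀ f (a , x) with a ≟ a₀
  ... | yes _ = a , f x
  ... | no  _ = a , x

  onFibre-here : ∀ a₀ f x → onFibre a₀ f (a₀ , x) ≡ (a₀ , f x)
  onFibre-here a₀ f x with a₀ ≟ a₀
  ... | yes _    = refl
  ... | no a₀≢a₀ = contradiction refl a₀≢a₀

  onFibre-elsewhere : ∀ {a₀ a} f x → a ≢ a₀ → onFibre a₀ f (a , x) ≡ (a , x)
  onFibre-elsewhere {a₀} {a} f x a≢a₀ with a ≟ a₀
  ... | yes a≡a₀ = contradiction a≡a₀ a≢a₀
  ... | no  _    = refl

  onFibre-inverse : ∀ a₀ {f g} → (∀ x → g (f x) ≡ x) → ∀ p → onFibre a₀ g (onFibre a₀ f p) ≡ p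
  onFibre-inverse a₀ {f} {g} gf (a , x) with a ≟ a₀
  ... | yes refl = trans (onFibre-here a₀ g (f x)) (cong (a₀ ,_) (gf x))
  ... | no  a≢a₀ = onFibre-elsewhere g x a≢a₀

  onFibre-adj : ∀ a₀ (τ : Permutation′ (n H)) → IsAut H τ → ∀ p q →
    lexAdjP G H (onFibre a₀ (τ ⟨$⟩ʳ_) p) (onFibre a₀ (τ ⟨$⟩ʳ_) q) ≡ lexAdjP G H p q
  onFibre-adj a₀ τ τ-aut (a , x) (b , y) with a ≟ a₀ | b ≟ a₀
  ... | yes refl | yes refl = trans (lexAdjP-fibre a₀ _ _) (trans (τ-aut x y) (sym (lexAdjP-fibre a₀ x y)))
  ... | yes refl | no  b≢a₀ = trans (lexAdjP-≢ _ y (b≢a₀ ∘ sym)) (sym (lexAdjP-≢ x y (b≢a₀ ∘ sym)))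
  ... | no  a≢a₀ | yes refl = trans (lexAdjP-≢ x _ a≢a₀) (sym (lexAdjP-≢ x y a≢a₀))
  ... | no  _    | no  _    = refl

  onFibreAut : Fin (n G) → (τ : Permutation′ (n H)) → IsAut H τ → PairAut
  onFibreAut a₀ τ τ-aut = record
    { to      = onFibre a₀ (τ ⟨$⟩ʳ_)
    ; from    = onFibre a₀ (τ ⟨$⟩ˡ_)
    ; from-to = onFibre-inverse a₀ (λ _ → inverseˡ τ)
    ; to-from = onFibre-inverse a₀ (λ _ → inverseʳ τ)
    ; to-adj  = onFibre-adj a₀ τ τ-aut
    }

  fibre-distinguishing : ∀ {r} a₀ (ψ : Fin (n (lex G H)) → Fin r) → IsDistinguishing (lex G H) ψ →
    IsDistinguishing H (λ x → ψ (pair (a₀ , x)))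
  fibre-distinguishing a₀ ψ ψ-dist τ τ-aut τ-pres x =
    proj₂ (combine-injective a₀ (τ ⟨$⟩ʳ x) a₀ x (begin
      pair (a₀ , τ ⟨$⟩ʳ x)      ≡⟨ cong pair (sym (onFibre-here a₀ _ x)) ⟩
      pair (PairAut.to π (a₀ , x)) ≡⟨ sym (toPermutation-pair π _) ⟩
      σ ⟨$⟩ʳ pair (a₀ , x)      ≡⟨ ψ-dist σ (toPermutation-aut π) ψ-pres _ ⟩
      pair (a₀ , x)            ∎))
    where
    π = onFibreAut a₀ τ τ-aut
    σ = toPermutation π
    ψ-pres-pair : ∀ p → ψ (pair (onFibre a₀ (τ ⟨$⟩ʳ_) p)) ≡ ψ (pair p)
    ψ-pres-pair (a , y) with a ≟ a₀
    ... | yes refl = τ-pres y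
    ... | no  _    = refl
    ψ-pres : ∀ i → ψ (σ ⟨$⟩ʳ i) ≡ ψ i
    ψ-pres i = trans (ψ-pres-pair (unpair i)) (cong ψ (pair-unpair i))

  restrictToFibre : ∀ {r} → Fin (n G) → HasDistLabeling (lex G H) r → HasDistLabeling H r
  restrictToFibre a₀ (ψ , ψ-dist) = (λ x → ψ (pair (a₀ , x))) , fibre-distinguishing a₀ ψ ψ-dist

  Wreath : Set
  Wreath = ∀ σ → IsAut (lex G H) σ → IsWreath σ

  lex-asymmetric : Wreath → Asymmetric G → Asymmetric H → Asymmetric (lex G H)
  lex-asymmetric wreath G-asym H-asym σ σ-aut with wreath σ σ-aut
  ... | α , α-aut , β , β-aut , σ-pair =
    wreath-identity σ α β σ-pair (G-asym α α-aut) (λ g → H-asym (β g) (β-aut g))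

  -- In fibre a the colour φ a is the only one of 0, …, d - 1 that is missing; since wreath
  -- automorphisms map fibres onto fibres, preserving the colouring forces α to preserve φ.
  lex-covering : ∀ {d r} → 1 < d → (φ : Fin (n G) → Fin d) → IsDistinguishing G φ → (∀ j → ∃ λ a → φ a ≡ j) →
    Wreath → HasCoveringDistLabeling H d r → HasCoveringDistLabeling (lex G H) d (suc r)
  lex-covering {d} {r} 1<d φ φ-dist φ-onto wreath (Λ , Λ-dist , Λ-covers) = L , L-dist , L-covers
    where
    colour : Pair → Fin (suc r)
    colour (a , x) = recolour (toℕ (φ a)) (Λ x)

    L : Fin (n (lex G H)) → Fin (suc r)
    L = colour ∘ unpair

    L-pair : ∀ p → L (pair p) ≡ colour p
    L-pair p = cong colour (unpair-pair p)

    L-dist : IsDistinguishing (lex G H) L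
    L-dist σ σ-aut L-pres with wreath σ σ-aut
    ... | α , α-aut , β , β-aut , σ-pair = wreath-identity σ α β σ-pair α-id β-id
      where
      pres : ∀ a x → colour (α ⟨$⟩ʳ a , β a ⟨$⟩ʳ x) ≡ colour (a , x)
      pres a x = begin
        colour (α ⟨$⟩ʳ a , β a ⟨$⟩ʳ x) ≡⟨ sym (L-pair _) ⟩
        L (pair (α ⟨$⟩ʳ a , β a ⟨$⟩ʳ x)) ≡⟨ cong L (sym (σ-pair a x)) ⟩
        L (σ ⟨$⟩ʳ pair (a , x))          ≡⟨ L-pres _ ⟩
        L (pair (a , x))                 ≡⟨ L-pair _ ⟩
        colour (a , x)                   ∎
      φ-α : ∀ a → φ (α ⟨$⟩ʳ a) ≡ φ a
      φ-α a = decidable-stable (_ ≟ _) λ φαa≢φa →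
        let w , Λw≡φa = Λ-covers (φ a)
            x = β a ⟨$⟩ˡ w
        in toℕ-recolour-≢ (toℕ (φ a)) (Λ x) (begin
          toℕ (colour (a , x))                     ≡⟨ cong toℕ (sym (pres a x)) ⟩
          toℕ (colour (α ⟨$⟩ʳ a , β a ⟨$⟩ʳ x))    ≡⟨ cong (λ y → toℕ (colour (α ⟨$⟩ʳ a , y))) (inverseʳ (β a)) ⟩
          toℕ (colour (α ⟨$⟩ʳ a , w))              ≡⟨ toℕ-recolour-keep _ (Λ w) (λ eq → φαa≢φa (toℕ-injective (trans (sym eq) Λw≡φa))) ⟩
          toℕ (Λ w)                                ≡⟨ Λw≡φa ⟩
          toℕ (φ a)                                ∎)
      α-id : ∀ a → α ⟨$⟩ʳ a ≡ a
      α-id = φ-dist α α-aut φ-α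
      β-id : ∀ a x → β a ⟨$⟩ʳ x ≡ x
      β-id a = Λ-dist (β a) (β-aut a) λ x →
        recolour-injective (toℕ (φ a)) (trans (cong (λ c → recolour (toℕ c) (Λ (β a ⟨$⟩ʳ x))) (sym (φ-α a))) (pres a x))

    L-covers : (j : Fin d) → ∃ λ v → toℕ (L v) ≡ toℕ j
    L-covers j with otherColour 1<d j
    ... | j′ , j′≢j with φ-onto j′ | Λ-covers j
    ...   | a , φa≡j′ | w , Λw≡j = pair (a , w) , (begin
      toℕ (L (pair (a , w)))             ≡⟨ cong toℕ (L-pair (a , w)) ⟩
      toℕ (recolour (toℕ (φ a)) (Λ w))   ≡⟨ cong (λ c → toℕ (recolour (toℕ c) (Λ w))) φa≡j′ ⟩
      toℕ (recolour (toℕ j′) (Λ w))      ≡⟨ toℕ-recolour-keep _ (Λ w) (λ eq → j′≢j (toℕ-injective (trans (sym eq) Λw≡j))) ⟩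
      toℕ (Λ w)                          ≡⟨ Λw≡j ⟩
      toℕ j                              ∎)

module Powers (G : Graph) (g₀ : Fin (n G)) (G-connected : ConnectedBy G true)
              (G-twinFree⊎coconnected : TwinFree G ⊎ ConnectedBy G false) where

  power : ℕ → Graph
  power k = lexPow G (suc k)

  basePoint : ∀ k → Fin (n (power k))
  basePoint ℕ.zero = g₀
  basePoint (suc k) = Lex.pair G (power k) (g₀ , basePoint k)

  power-connectedBy : ∀ {b} → ConnectedBy G b → ∀ k → ConnectedBy (power k) b
  power-connectedBy G-conn ℕ.zero = G-conn
  power-connectedBy G-conn (suc k) =
    Lex.lex-connectedBy G (power k) (basePoint k) G-conn (power-connectedBy G-conn k)

  power-wreath : ∀ k → LexLabelings.Wreath G (power k)
  power-wreath k = Decomposition.aut⇒wreath G (power k) (power-connectedBy G-connected k)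
    (Sum.map₂ (λ G-coconnected → power-connectedBy G-coconnected k) G-twinFree⊎coconnected) (basePoint k)

  power-restrict : ∀ {r} k → HasDistLabeling (power k) r → HasDistLabeling G r
  power-restrict ℕ.zero = id
  power-restrict (suc k) = power-restrict k ∘ LexLabelings.restrictToFibre G (power k) g₀

  power-asymmetric : Asymmetric G → ∀ k → Asymmetric (power k)
  power-asymmetric G-asym ℕ.zero = G-asym
  power-asymmetric G-asym (suc k) =
    LexLabelings.lex-asymmetric G (power k) (power-wreath k) G-asym (power-asymmetric G-asym k)

  power-covering : ∀ {d} → 1 < d → (φ : Fin (n G) → Fin d) → IsDistinguishing G φ → (∀ j → ∃ λ a → φ a ≡ j) →
    ∀ k → HasCoveringDistLabeling (power k) d (d + k)
  power-covering {d} 1<d φ φ-dist φ-onto ℕ.zero =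
    subst (HasCoveringDistLabeling G d) (sym (+-identityʳ d))
      (φ , φ-dist , λ j → let a , φa≡j = φ-onto j in a , cong toℕ φa≡j)
  power-covering {d} 1<d φ φ-dist φ-onto (suc k) =
    subst (HasCoveringDistLabeling (power (suc k)) d) (sym (+-suc d k))
      (LexLabelings.lex-covering G (power k) 1<d φ φ-dist φ-onto (power-wreath k)
        (power-covering 1<d φ φ-dist φ-onto k))

corollary2p4 : (G : Graph) → Connected G → AutLexIsWreath G →
    (k : ℕ) → .{{_ : NonZero k}} → (d dk : ℕ) →
    IsDistNumber G d → IsDistNumber (lexPow G k) dk →
    (1 < d → d ≤ dk × dk ≤ d + k ∸ 1) × (d ≡ 1 → dk ≡ 1)
corollary2p4 G G-connected G-wreath ℕ.zero {{()}} d dk _ _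
corollary2p4 G G-connected G-wreath (suc k) d dk ((φ , φ-dist) , minimal) ((ψ , ψ-dist) , minimalₖ) =
  (λ 1<d → d≤dk , upper 1<d) , asymmetric
  where
  open Powers G (fromℕ< (proj₁ G-connected)) (connected⇒connectedBy-true G G-connected)
              (wreath⇒twinFree⊎coconnected G G-wreath)

  d≤dk : d ≤ dk
  d≤dk = minimal dk (power-restrict k (ψ , ψ-dist))

  upper : 1 < d → dk ≤ d + suc k ∸ 1
  upper 1<d with power-covering 1<d φ φ-dist (minimal-labeling-surjective G φ φ-dist minimal) k
  ... | Λ , Λ-dist , _ = subst (λ m → dk ≤ m ∸ 1) (sym (+-suc d k)) (minimalₖ (d + k) (Λ , Λ-dist))

  asymmetric : d ≡ 1 → dk ≡ 1
  asymmetric refl = ≤-antisym (minimalₖ 1 (asymmetric⇒1-labeling (power k) Gᵏ-asym)) d≤dk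
    where Gᵏ-asym = power-asymmetric (1-labeling⇒asymmetric G (φ , φ-dist)) k
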